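{- Let $(D,\le)$ be an algebraic $L$-domain and $(\mathcal{L}(P_D),\vdash_D)$ its associated disjunctive sequent calculus. Then: (1) a formula $\varphi$ is a tautology iff $\widehat\varphi=D$; (2) $\varphi$ is a contradiction iff $\widehat\varphi=\emptyset$; (3) $\varphi$ is satisfiable iff $\widehat\varphi=\uparrow A$ for some nonempty pairwise inconsistent subset $A$ of $K^*(D)$; (4) two formulae $\varphi,\psi$ are logically equivalent iff $\widehat\varphi=\widehat\psi$; (5) for any finite subset $\{x_1,\dots,x_n\}$ of $K^*(D)$, $\uparrow x_1\wedge\dots\wedge\uparrow x_n$ is a conjunction iff $\{x_1,\dots,x_n\}$ has an upper bound in $D$.
   Context: An algebraic $L$-domain is a dcpo with least element $\bot$ in which every element is the directed supremum of the compact elements below it and every principal ideal $\downarrow x$ is a complete lattice; $K(D)$ is the set of compact elements, $K^*(D)=K(D)\setminus\{\bot\}$. A subset $A$ is pairwise inconsistent if $\uparrow a\cap\uparrow b=\emptyset$ for all distinct $a,b\in A$. Associated calculus: atomic formulae $P_D=\{\uparrow x: x\in K^*(D)\}$. Formulae $\mathcal{L}(P_D)$ and $\widehat{\cdot}$ defined by induction: $\uparrow x\in P_D$ is a formula with $\widehat{\uparrow x}=\uparrow x$; $\mathrm{T},\mathrm{F}$ with $\widehat{\mathrm{T}}=D$, $\widehat{\mathrm{F}}=\emptyset$; $\varphi\wedge\psi$ with $\widehat{\varphi\wedge\psi}=\widehat\varphi\cap\widehat\psi$; $\dot{\bigvee}_{i\in I}\varphi_i$ whenever $\widehat{\varphi_i}\cap\widehat{\varphi_j}=\emptyset$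 for $i\ne j$, with $\widehat{\dot{\bigvee}_i\varphi_i}=\bigcup_i\widehat{\varphi_i}$. A sequent $\psi_1,\dots,\psi_n\vdash_D\varphi$ is valid iff $\widehat{\psi_1}\cap\dots\cap\widehat{\psi_n}\subseteq\widehat\varphi$ (empty intersection $=D$). A formula $\varphi$ is a tautology if $\mathrm{T}\vdash_D\varphi$ is valid, a contradiction if $\varphi\vdash_D\mathrm{F}$ is valid, satisfiable if neither. Two formulae $\varphi,\psi$ are logically equivalent if both $\varphi\vdash_D\psi$ and $\psi\vdash_D\varphi$ are valid. A conjunction is a satisfiable formula built from atomic formulae using only $\wedge$. -}

module Defs where

open import Level using (Level; _⊔_; suc; Lift; lift)
open import Data.Product using (Σ; ∃; ∃-syntax; _×_; _,_)
open import Data.Unit using (⊤)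
open import Data.Empty using (⊥)
open import Data.Nat using (ℕ)
open import Data.Fin using (Fin)
open import Data.Vec using (Vec; _∷_; [])
open import Data.List using (List; _∷_; [])
open import Data.List.Relation.Unary.All using (All)
open import Relation.Nullary using (¬_)
open import Relation.Unary using (Pred; _∈_; _⊆_; _≐_)
open import Relation.Binary.Bundles using (Poset)
open import Relation.Binary.PropositionalEquality using (_≡_)

module OrderTheory {a : Level} (P : Poset a a a) where
  open Poset P renaming (Carrier to D)

  Directed : ∀ {ℓ} → Pred D ℓ → Set (a ⊔ ℓ)
  Directed S = (∃[ x ] S x) × (∀ x y → S x → S y → ∃[ z ] (S z × x ≤ z × y ≤ z))

  IsLub : ∀ {ℓ} → Pred D ℓ → D → Set (a ⊔ ℓ)
  IsLub S x = (∀ y → S y → y ≤ x) × (∀ u → (∀ y → S y → y ≤ u) → x ≤ u)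

  IsDcpo : Set (suc a)
  IsDcpo = ∀ (S : Pred D a) → Directed S → ∃[ x ] IsLub S x

  Compact : D → Set (suc a)
  Compact k = ∀ (S : Pred D a) → Directed S → ∀ s → IsLub S s → k ≤ s →
              ∃[ y ] (S y × k ≤ y)

  ↓ : D → Pred D a
  ↓ x y = y ≤ x

  ↑ : D → Pred D a
  ↑ x y = x ≤ y

  PrincipalIdealComplete : D → Set (suc a)
  PrincipalIdealComplete x =
    ∀ (S : Pred D a) → S ⊆ ↓ x →
      ∃[ s ] (s ≤ x × (∀ y → S y → y ≤ s)
                    × (∀ u → u ≤ x → (∀ y → S y → y ≤ u) → s ≤ u))

record AlgebraicLDomain {a : Level} (P : Poset a a a) : Set (suc a) where
  open Poset P renaming (Carrier to D)
  open OrderTheory P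
  field
    dcpo      : IsDcpo
    bot       : D
    bot-least : ∀ x → bot ≤ x
    algebraic : ∀ x → Directed (λ k → Compact k × k ≤ x)
                    × IsLub (λ k → Compact k × k ≤ x) x
    L-domain  : ∀ x → PrincipalIdealComplete x

module Calculus {a : Level} (P : Poset a a a) (L : AlgebraicLDomain P) where
  open Poset P renaming (Carrier to D)
  open OrderTheory P
  open AlgebraicLDomain L

  K* : D → Set (suc a)
  K* x = Compact x × ¬ (x ≈ bot)

  Disjoint : Pred D a → Pred D a → Set a
  Disjoint A B = ∀ x → ¬ (A x × B x)

  infixr 6 _∧_
  mutual
    data Form : Set (suc a) where
      atom : (x : D) → K* x → Form
      T F  : Form
      _∧_  : Form → Form → Form
      ⋁    : (I : Set a) (φ : I → Form) →
             (∀ i j → ¬ (i ≡ j) → Disjoint ⟦ φ i ⟧ ⟦ φ j ⟧) → Form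

    ⟦_⟧ : Form → Pred D a
    ⟦ atom x _ ⟧ = ↑ x
    ⟦ T ⟧        = λ _ → Lift a ⊤
    ⟦ F ⟧        = λ _ → Lift a ⊥
    ⟦ φ ∧ ψ ⟧    = λ x → ⟦ φ ⟧ x × ⟦ ψ ⟧ x
    ⟦ ⋁ I φ _ ⟧  = λ x → Σ I (λ i → ⟦ φ i ⟧ x)

  Valid : List Form → Form → Set (suc a)
  Valid ψs φ = ∀ x → All (λ ψ → ⟦ ψ ⟧ x) ψs → ⟦ φ ⟧ x

  Tautology : Form → Set (suc a)
  Tautology φ = Valid (T ∷ []) φ

  Contradiction : Form → Set (suc a)
  Contradiction φ = Valid (φ ∷ []) F

  Satisfiable : Form → Set (suc a)
  Satisfiable φ = ¬ Tautology φ × ¬ Contradiction φ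

  LogicallyEquivalent : Form → Form → Set (suc a)
  LogicallyEquivalent φ ψ = Valid (φ ∷ []) ψ × Valid (ψ ∷ []) φ

  data AtomsAndConj : Form → Set (suc a) where
    atom : ∀ x (k : K* x) → AtomsAndConj (atom x k)
    _∧_  : ∀ {φ ψ} → AtomsAndConj φ → AtomsAndConj ψ → AtomsAndConj (φ ∧ ψ)

  IsConjunction : Form → Set (suc a)
  IsConjunction φ = AtomsAndConj φ × Satisfiable φ

  bigAnd : ∀ {n} → Vec (Σ D K*) (Data.Nat.suc n) → Form
  bigAnd ((x , k) ∷ [])      = atom x k
  bigAnd ((x , k) ∷ (y ∷ ys)) = atom x k ∧ bigAnd (y ∷ ys)

  UpSet : Pred D a → Pred D a
  UpSet A y = ∃[ x ] (A x × x ≤ y)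

  PairwiseInconsistent : Pred D a → Set a
  PairwiseInconsistent A =
    ∀ x y → A x → A y → ¬ (x ≈ y) → ¬ (∃[ z ] (x ≤ z × y ≤ z))

-- Every interpretation φ̂ is either D or ↑A for a pairwise inconsistent A ⊆ K*(D).
-- Atoms and F are of this form, and a disjoint ⋁ of such sets is again one, the
-- union of the generators being pairwise inconsistent by disjointness. For ∧ one
-- uses ↑a ∩ ↑b = ↑{minimal upper bounds of a and b}: in an L-domain two minimal
-- upper bounds of a, b lying below a common element coincide (both equal the
-- supremum of a, b in that principal ideal), which makes them compact and the
-- resulting generating sets pairwise inconsistent. Given this normal form,
-- ⊥ ∉ ↑A shows that a satisfiable formula has a nonempty generating set; the
-- remaining claims unfold the definition of validity.
module Submission where

open import Defs
open import Level using (Level; lift; lower)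
open import Data.Nat using (suc)
open import Data.Fin using (Fin; zero; suc)
open import Data.Vec using (Vec; lookup; _∷_; [])
open import Data.Product using (Σ; ∃; ∃-syntax; _×_; proj₁; proj₂; _,_)
open import Data.Sum using (_⊎_; inj₁; inj₂)
open import Data.Empty using (⊥-elim)
open import Data.Unit using (tt)
open import Data.List using (_∷_; [])
open import Data.List.Relation.Unary.All using (_∷_; [])
open import Relation.Nullary using (¬_; Dec; yes; no)
open import Relation.Nullary.Decidable using (map′; decidable-stable)
open import Relation.Unary using (Pred; U; ∅; _≐_; _⊆_; _∩_)
open import Relation.Binary.Bundles using (Poset)
open import Relation.Binary.PropositionalEquality using (_≡_; refl)
open import Function.Bundles using (_⇔_; mk⇔; module Equivalence)
open import Axiom.ExcludedMiddle using (ExcludedMiddle)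

module MinimalUpperBounds {a : Level} (P : Poset a a a) where
  open Poset P renaming (Carrier to D; trans to ≤-trans) hiding (refl)
  open OrderTheory P

  MinimalUpperBound : D → D → D → Set a
  MinimalUpperBound p q z = p ≤ z × q ≤ z × (∀ u → u ≤ z → p ≤ u → q ≤ u → z ≤ u)

  minimalUpperBound-resp-≈ : ∀ {p p′ q q′ z} → p ≈ p′ → q ≈ q′ →
    MinimalUpperBound p′ q′ z → MinimalUpperBound p q z
  minimalUpperBound-resp-≈ p≈p′ q≈q′ (p′≤z , q′≤z , minimal) =
    ≤-trans (reflexive p≈p′) p′≤z , ≤-trans (reflexive q≈q′) q′≤z ,
    λ u u≤z p≤u q≤u →
      minimal u u≤z (≤-trans (reflexive (Eq.sym p≈p′)) p≤u)
                    (≤-trans (reflexive (Eq.sym q≈q′)) q≤u)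

  module _ (complete : ∀ x → PrincipalIdealComplete x) where

    supBelow : ∀ {p q y} → p ≤ y → q ≤ y →
      ∃[ m ] (m ≤ y × p ≤ m × q ≤ m × (∀ u → u ≤ y → p ≤ u → q ≤ u → m ≤ u))
    supBelow {p} {q} {y} p≤y q≤y with complete y (λ w → w ≡ p ⊎ w ≡ q) pair⊆↓y
      where
      pair⊆↓y : ∀ {w} → w ≡ p ⊎ w ≡ q → w ≤ y
      pair⊆↓y (inj₁ refl) = p≤y
      pair⊆↓y (inj₂ refl) = q≤y
    ... | m , m≤y , upper , least =
      m , m≤y , upper p (inj₁ refl) , upper q (inj₂ refl) ,
      λ u u≤y p≤u q≤u → least u u≤y λ { _ (inj₁ refl) → p≤u ; _ (inj₂ refl) → q≤u }

    minimalUpperBound-below : ∀ {p q y} → p ≤ y → q ≤ y →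
      ∃[ m ] (MinimalUpperBound p q m × m ≤ y)
    minimalUpperBound-below p≤y q≤y with supBelow p≤y q≤y
    ... | m , m≤y , p≤m , q≤m , least =
      m , (p≤m , q≤m , λ u u≤m → least u (≤-trans u≤m m≤y)) , m≤y

    minimalUpperBound-unique : ∀ {p q z z′ v} →
      MinimalUpperBound p q z → MinimalUpperBound p q z′ → z ≤ v → z′ ≤ v → z ≈ z′
    minimalUpperBound-unique {z = z} {z′} (p≤z , q≤z , minimal) (p≤z′ , q≤z′ , minimal′)
                             z≤v z′≤v
      with supBelow (≤-trans p≤z z≤v) (≤-trans q≤z z≤v)
    ... | m , _ , p≤m , q≤m , least =
      let m≤z  = least z z≤v p≤z q≤z
          m≤z′ = least z′ z′≤v p≤z′ q≤z′
      in antisym (≤-trans (minimal m m≤z p≤m q≤m) m≤z′)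
                 (≤-trans (minimal′ m m≤z′ p≤m q≤m) m≤z)

    minimalUpperBound-compact : ∀ {p q z} → Compact p → Compact q →
      MinimalUpperBound p q z → Compact z
    minimalUpperBound-compact cp cq mub@(p≤z , q≤z , _) S directed s sup z≤s
      with cp S directed s sup (≤-trans p≤z z≤s) | cq S directed s sup (≤-trans q≤z z≤s)
    ... | y₁ , Sy₁ , p≤y₁ | y₂ , Sy₂ , q≤y₂ with proj₂ directed y₁ y₂ Sy₁ Sy₂
    ... | y , Sy , y₁≤y , y₂≤y
      with minimalUpperBound-below (≤-trans p≤y₁ y₁≤y) (≤-trans q≤y₂ y₂≤y)
    ... | w , mubw , w≤y =
      let y≤s = proj₁ sup y Sy
          z≈w = minimalUpperBound-unique mub mubw z≤s (≤-trans w≤y y≤s)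
      in y , Sy , ≤-trans (reflexive z≈w) w≤y

module Semantics {a : Level} (P : Poset a a a) (L : AlgebraicLDomain P) where
  open Poset P renaming (Carrier to D)
  open AlgebraicLDomain L
  open Calculus P L

  K*⇒≰bot : ∀ {x} → K* x → ¬ x ≤ bot
  K*⇒≰bot (_ , x≉bot) x≤bot = x≉bot (antisym x≤bot (bot-least _))

  bot∉UpSet : ∀ {A} → (∀ x → A x → K* x) → ¬ UpSet A bot
  bot∉UpSet A⊆K* (x , Ax , x≤bot) = K*⇒≰bot (A⊆K* x Ax) x≤bot

  valid⇒⊆ : ∀ ψ φ → Valid (ψ ∷ []) φ → ⟦ ψ ⟧ ⊆ ⟦ φ ⟧
  valid⇒⊆ _ _ ψ⊢φ {x} ψx = ψ⊢φ x (ψx ∷ [])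

  ⊆⇒valid : ∀ ψ φ → ⟦ ψ ⟧ ⊆ ⟦ φ ⟧ → Valid (ψ ∷ []) φ
  ⊆⇒valid _ _ ψ⊆φ x (ψx ∷ []) = ψ⊆φ ψx

  tautology⇔≐U : ∀ φ → Tautology φ ⇔ (⟦ φ ⟧ ≐ U)
  tautology⇔≐U φ = mk⇔ (λ t → (λ {_} _ → tt) , λ {_} _ → valid⇒⊆ T φ t (lift tt))
                       (λ φ≐U → ⊆⇒valid T φ λ {_} _ → proj₂ φ≐U tt)

  contradiction⇔≐∅ : ∀ φ → Contradiction φ ⇔ (⟦ φ ⟧ ≐ ∅)
  contradiction⇔≐∅ φ = mk⇔ (λ c → (λ {_} φx → lower (valid⇒⊆ φ F c φx)) , λ ())
                           (λ φ≐∅ → ⊆⇒valid φ F λ {_} φx → ⊥-elim (proj₁ φ≐∅ φx))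

  logicallyEquivalent⇔≐ : ∀ φ ψ → LogicallyEquivalent φ ψ ⇔ (⟦ φ ⟧ ≐ ⟦ ψ ⟧)
  logicallyEquivalent⇔≐ φ ψ =
    mk⇔ (λ (φ⊢ψ , ψ⊢φ) → valid⇒⊆ φ ψ φ⊢ψ , valid⇒⊆ ψ φ ψ⊢φ)
        (λ (φ⊆ψ , ψ⊆φ) → ⊆⇒valid φ ψ φ⊆ψ , ⊆⇒valid ψ φ ψ⊆φ)

  inhabited⇒¬contradiction : ∀ φ {x} → ⟦ φ ⟧ x → ¬ Contradiction φ
  inhabited⇒¬contradiction φ φx c = lower (valid⇒⊆ φ F c φx)

  bot∉⇒¬tautology : ∀ φ → ¬ ⟦ φ ⟧ bot → ¬ Tautology φ
  bot∉⇒¬tautology φ bot∉φ t = bot∉φ (valid⇒⊆ T φ t (lift tt))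

  bigAnd-atomsAndConj : ∀ {n} (xs : Vec (Σ D K*) (suc n)) → AtomsAndConj (bigAnd xs)
  bigAnd-atomsAndConj ((x , k) ∷ [])     = atom x k
  bigAnd-atomsAndConj ((x , k) ∷ y ∷ ys) = atom x k ∧ bigAnd-atomsAndConj (y ∷ ys)

  bigAnd⇒upperBound : ∀ {n u} (xs : Vec (Σ D K*) (suc n)) →
    ⟦ bigAnd xs ⟧ u → ∀ i → proj₁ (lookup xs i) ≤ u
  bigAnd⇒upperBound (_ ∷ [])     x≤u      zero    = x≤u
  bigAnd⇒upperBound (_ ∷ _ ∷ _)  (x≤u , _) zero    = x≤u
  bigAnd⇒upperBound (_ ∷ y ∷ ys) (_ , ys≤u) (suc i) = bigAnd⇒upperBound (y ∷ ys) ys≤u i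

  upperBound⇒bigAnd : ∀ {n u} (xs : Vec (Σ D K*) (suc n)) →
    (∀ i → proj₁ (lookup xs i) ≤ u) → ⟦ bigAnd xs ⟧ u
  upperBound⇒bigAnd (_ ∷ [])     xs≤u = xs≤u zero
  upperBound⇒bigAnd (_ ∷ y ∷ ys) xs≤u =
    xs≤u zero , upperBound⇒bigAnd (y ∷ ys) (λ i → xs≤u (suc i))

module Classical {a : Level} (em : ExcludedMiddle (Level.suc a))
  (P : Poset a a a) (L : AlgebraicLDomain P) where
  open Poset P renaming (Carrier to D; refl to ≤-refl; trans to ≤-trans)
  open OrderTheory P
  open AlgebraicLDomain L
  open Calculus P L
  open MinimalUpperBounds P
  open Semantics P L

  dec : (X : Set a) → Dec X
  dec X = map′ lower lift em

  stable : {X : Set a} → ¬ ¬ X → X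
  stable {X} = decidable-stable (dec X)

  ¬contradiction⇒inhabited : ∀ φ → ¬ Contradiction φ → ∃ ⟦ φ ⟧
  ¬contradiction⇒inhabited φ ¬c =
    stable λ empty → ¬c λ x → λ { (φx ∷ []) → ⊥-elim (empty (x , φx)) }

  record InconsistentBasis (X : Pred D a) : Set (Level.suc a) where
    field
      basis              : Pred D a
      basis⊆K*           : ∀ x → basis x → K* x
      basis-inconsistent : PairwiseInconsistent basis
      generates          : X ≐ UpSet basis
  open InconsistentBasis

  ↑-inconsistentBasis : ∀ {x} → K* x → InconsistentBasis (↑ x)
  ↑-inconsistentBasis {x} k = record
    { basis              = x ≡_
    ; basis⊆K*           = λ { _ refl → k }
    ; basis-inconsistent = λ { _ _ refl refl x≉x _ → x≉x Eq.refl }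
    ; generates          = (λ x≤y → x , refl , x≤y) , λ { (_ , refl , x≤y) → x≤y }
    }

  empty-inconsistentBasis : ∀ {X} → (∀ x → ¬ X x) → InconsistentBasis X
  empty-inconsistentBasis {X} empty = record
    { basis              = X
    ; basis⊆K*           = λ x Xx → ⊥-elim (empty x Xx)
    ; basis-inconsistent = λ x _ Xx → ⊥-elim (empty x Xx)
    ; generates          = (λ {x} Xx → ⊥-elim (empty x Xx))
                         , λ { (x , Xx , _) → ⊥-elim (empty x Xx) }
    }

  ≐-inconsistentBasis : ∀ {X Y} → X ≐ Y → InconsistentBasis Y → InconsistentBasis X
  ≐-inconsistentBasis (X⊆Y , Y⊆X) BY = record
    { basis              = basis BY
    ; basis⊆K*           = basis⊆K* BY
    ; basis-inconsistent = basis-inconsistent BY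
    ; generates          = (λ Xy → proj₁ (generates BY) (X⊆Y Xy))
                         , λ ↑y → Y⊆X (proj₂ (generates BY) ↑y)
    }

  ∩-inconsistentBasis : ∀ {X Y} → InconsistentBasis X → InconsistentBasis Y →
    InconsistentBasis (X ∩ Y)
  ∩-inconsistentBasis {X} {Y} BX BY = record
    { basis              = C
    ; basis⊆K*           = C⊆K*
    ; basis-inconsistent = C-inconsistent
    ; generates          = to , from
    }
    where
    A = basis BX
    B = basis BY

    C : Pred D a
    C z = ∃[ p ] ∃[ q ] (A p × B q × MinimalUpperBound p q z)

    C⊆K* : ∀ z → C z → K* z
    C⊆K* z (p , q , Ap , Bq , mub@(p≤z , _)) =
      let kp = basis⊆K* BX p Ap in
      minimalUpperBound-compact L-domain (proj₁ kp) (proj₁ (basis⊆K* BY q Bq)) mub ,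
      λ z≈bot → K*⇒≰bot kp (≤-trans p≤z (reflexive z≈bot))

    C-inconsistent : PairwiseInconsistent C
    C-inconsistent z z′ (p , q , Ap , Bq , mub@(p≤z , q≤z , _))
                        (p′ , q′ , Ap′ , Bq′ , mub′@(p′≤z′ , q′≤z′ , _))
                        z≉z′ (v , z≤v , z′≤v)
      with dec (p ≈ p′) | dec (q ≈ q′)
    ... | no p≉p′ | _ =
      basis-inconsistent BX p p′ Ap Ap′ p≉p′ (v , ≤-trans p≤z z≤v , ≤-trans p′≤z′ z′≤v)
    ... | yes _ | no q≉q′ =
      basis-inconsistent BY q q′ Bq Bq′ q≉q′ (v , ≤-trans q≤z z≤v , ≤-trans q′≤z′ z′≤v)
    ... | yes p≈p′ | yes q≈q′ =
      z≉z′ (minimalUpperBound-unique L-domain mub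
              (minimalUpperBound-resp-≈ p≈p′ q≈q′ mub′) z≤v z′≤v)

    to : X ∩ Y ⊆ UpSet C
    to (Xy , Yy) with proj₁ (generates BX) Xy | proj₁ (generates BY) Yy
    ... | p , Ap , p≤y | q , Bq , q≤y with minimalUpperBound-below L-domain p≤y q≤y
    ... | m , mub , m≤y = m , (p , q , Ap , Bq , mub) , m≤y

    from : UpSet C ⊆ X ∩ Y
    from (_ , (p , q , Ap , Bq , p≤z , q≤z , _) , z≤y) =
      proj₂ (generates BX) (p , Ap , ≤-trans p≤z z≤y) ,
      proj₂ (generates BY) (q , Bq , ≤-trans q≤z z≤y)

  ⋃-inconsistentBasis : ∀ {I : Set a} (X : I → Pred D a) →
    (∀ i j → ¬ i ≡ j → Disjoint (X i) (X j)) → (∀ i → InconsistentBasis (X i)) →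
    InconsistentBasis (λ y → Σ I λ i → X i y)
  ⋃-inconsistentBasis {I} X disjoint BX = record
    { basis              = A
    ; basis⊆K*           = λ { x (i , Aᵢx) → basis⊆K* (BX i) x Aᵢx }
    ; basis-inconsistent = A-inconsistent
    ; generates          = to , from
    }
    where
    A : Pred D a
    A x = Σ I λ i → basis (BX i) x

    A-inconsistent : PairwiseInconsistent A
    A-inconsistent x y (i , Aᵢx) (j , Aⱼy) x≉y (v , x≤v , y≤v) with dec (i ≡ j)
    ... | yes refl = basis-inconsistent (BX i) x y Aᵢx Aⱼy x≉y (v , x≤v , y≤v)
    ... | no i≢j   = disjoint i j i≢j v (proj₂ (generates (BX i)) (x , Aᵢx , x≤v) ,
                                         proj₂ (generates (BX j)) (y , Aⱼy , y≤v))

    to : ∀ {y} → Σ I (λ i → X i y) → UpSet A y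
    to (i , Xᵢy) with proj₁ (generates (BX i)) Xᵢy
    ... | x , Aᵢx , x≤y = x , (i , Aᵢx) , x≤y

    from : ∀ {y} → UpSet A y → Σ I (λ i → X i y)
    from (x , (i , Aᵢx) , x≤y) = i , proj₂ (generates (BX i)) (x , Aᵢx , x≤y)

  NormalForm : Pred D a → Set (Level.suc a)
  NormalForm X = X ≐ U ⊎ InconsistentBasis X

  ∩-normalForm : ∀ {X Y} → NormalForm X → NormalForm Y → NormalForm (X ∩ Y)
  ∩-normalForm (inj₁ X≐U) (inj₁ Y≐U) =
    inj₁ ((λ _ → tt) , λ _ → proj₂ X≐U tt , proj₂ Y≐U tt)
  ∩-normalForm (inj₁ X≐U) (inj₂ BY)  =
    inj₂ (≐-inconsistentBasis (proj₂ , λ Yy → proj₂ X≐U tt , Yy) BY)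
  ∩-normalForm (inj₂ BX)  (inj₁ Y≐U) =
    inj₂ (≐-inconsistentBasis (proj₁ , λ Xy → Xy , proj₂ Y≐U tt) BX)
  ∩-normalForm (inj₂ BX)  (inj₂ BY)  = inj₂ (∩-inconsistentBasis BX BY)

  ⟦⟧-normalForm : ∀ φ → NormalForm ⟦ φ ⟧
  ⟦⟧-normalForm (atom x k) = inj₂ (↑-inconsistentBasis k)
  ⟦⟧-normalForm T          = inj₁ ((λ _ → tt) , λ _ → lift tt)
  ⟦⟧-normalForm F          = inj₂ (empty-inconsistentBasis λ _ ())
  ⟦⟧-normalForm (φ ∧ ψ)    = ∩-normalForm (⟦⟧-normalForm φ) (⟦⟧-normalForm ψ)
  ⟦⟧-normalForm (⋁ I φ disjoint) with dec (Σ I λ i → ⟦ φ i ⟧ ≐ U)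
  ... | yes (i , φᵢ≐U) = inj₁ ((λ _ → tt) , λ _ → i , proj₂ φᵢ≐U tt)
  ... | no ¬total = inj₂ (⋃-inconsistentBasis (λ i → ⟦ φ i ⟧) disjoint basisᵢ)
    where
    basisᵢ : ∀ i → InconsistentBasis ⟦ φ i ⟧
    basisᵢ i with ⟦⟧-normalForm (φ i)
    ... | inj₁ φᵢ≐U = ⊥-elim (¬total (i , φᵢ≐U))
    ... | inj₂ B    = B

  HasNonemptyInconsistentBasis : Pred D a → Set (Level.suc a)
  HasNonemptyInconsistentBasis X =
    ∃[ A ] ((∀ x → A x → K* x) × (∃[ x ] A x) × PairwiseInconsistent A × (X ≐ UpSet A))

  satisfiable⇔nonemptyInconsistentBasis : ∀ φ →
    Satisfiable φ ⇔ HasNonemptyInconsistentBasis ⟦ φ ⟧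
  satisfiable⇔nonemptyInconsistentBasis φ = mk⇔ to from
    where
    to : Satisfiable φ → HasNonemptyInconsistentBasis ⟦ φ ⟧
    to (¬t , ¬c) with ⟦⟧-normalForm φ
    ... | inj₁ φ≐U = ⊥-elim (¬t (Equivalence.from (tautology⇔≐U φ) φ≐U))
    ... | inj₂ B with ¬contradiction⇒inhabited φ ¬c
    ...   | _ , φx with proj₁ (generates B) φx
    ...     | b , Ab , _ = basis B , basis⊆K* B , (b , Ab) , basis-inconsistent B , generates B
    from : HasNonemptyInconsistentBasis ⟦ φ ⟧ → Satisfiable φ
    from (A , A⊆K* , (x , Ax) , _ , φ≐↑A) =
      bot∉⇒¬tautology φ (λ φbot → bot∉UpSet A⊆K* (proj₁ φ≐↑A φbot)) ,
      inhabited⇒¬contradiction φ (proj₂ φ≐↑A (x , Ax , ≤-refl))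

  isConjunction⇔bounded : ∀ n (xs : Vec (Σ D K*) (suc n)) →
    IsConjunction (bigAnd xs) ⇔ (∃[ u ] (∀ (i : Fin (suc n)) → proj₁ (lookup xs i) ≤ u))
  isConjunction⇔bounded n xs = mk⇔ to from
    where
    to : IsConjunction (bigAnd xs) → ∃[ u ] (∀ i → proj₁ (lookup xs i) ≤ u)
    to (_ , _ , ¬c) with ¬contradiction⇒inhabited (bigAnd xs) ¬c
    ... | u , ⟦xs⟧u = u , bigAnd⇒upperBound xs ⟦xs⟧u
    from : ∃[ u ] (∀ i → proj₁ (lookup xs i) ≤ u) → IsConjunction (bigAnd xs)
    from (u , xs≤u) =
      bigAnd-atomsAndConj xs ,
      bot∉⇒¬tautology (bigAnd xs)
        (λ ⟦xs⟧bot → K*⇒≰bot (proj₂ (lookup xs zero)) (bigAnd⇒upperBound xs ⟦xs⟧bot zero)) ,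
      inhabited⇒¬contradiction (bigAnd xs) (upperBound⇒bigAnd xs xs≤u)

proposition3p5 : ∀ {a : Level} → ExcludedMiddle (Level.suc a) →
  (P : Poset a a a) (L : AlgebraicLDomain P) →
  let open Poset P renaming (Carrier to D) in
  let open Calculus P L in
  (∀ φ → Tautology φ ⇔ (⟦ φ ⟧ ≐ U))
  × (∀ φ → Contradiction φ ⇔ (⟦ φ ⟧ ≐ ∅))
  × (∀ φ → Satisfiable φ ⇔
       (∃[ A ] ((∀ x → A x → K* x) × (∃[ x ] A x)
                × PairwiseInconsistent A × (⟦ φ ⟧ ≐ UpSet A))))
  × (∀ φ ψ → LogicallyEquivalent φ ψ ⇔ (⟦ φ ⟧ ≐ ⟦ ψ ⟧))
  × (∀ n (xs : Vec (Σ D K*) (suc n)) →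
       IsConjunction (bigAnd xs) ⇔
       (∃[ u ] (∀ (i : Fin (suc n)) → proj₁ (lookup xs i) ≤ u)))
proposition3p5 em P L =
  tautology⇔≐U , contradiction⇔≐∅ , satisfiable⇔nonemptyInconsistentBasis ,
  logicallyEquivalent⇔≐ , isConjunction⇔bounded
  where
  open Semantics P L
  open Classical em P L
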